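{- Let $\langle P_1,\unlhd_1\rangle$ and $\langle P_2,\unlhd_2\rangle$ be partial orders and let $\Psi:\langle P_1,\unlhd_1\rangle\to\langle P_2,\unlhd_2\rangle$ be an order isomorphism which fixes every element of $P_1\cap P_2$. Then there is a unique partial order $\unlhd_3$ on $P_1\cup P_2$ satisfying: (i) for all $x,y\in P_1$, $x\unlhd_3 y$ iff $x\unlhd_1 y$; (ii) for all $x,y\in P_2$, $x\unlhd_3 y$ iff $x\unlhd_2 y$; (iii) for all $x\in P_1\setminus P_2$ and $y\in P_2\setminus P_1$, $x\unlhd_3 y$ iff $\Psi(x)\unlhd_2 y$; (iv) for all $x\in P_2\setminus P_1$ and $y\in P_1\setminus P_2$, $x\unlhd_3 y$ iff there is $w\in P_1\cap P_2$ with $x\unlhd_2 w$ and $w\unlhd_1 y$. -}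

module Defs where

open import Level using (Level)
open import Data.Product using (Σ; _×_; _,_; ∃-syntax)
open import Data.Sum using (_⊎_)
open import Relation.Nullary using (¬_)
open import Relation.Binary.PropositionalEquality using (_≡_)
open import Relation.Unary using (Pred; _∈_; _∉_; _∪_; _∩_)
open import Relation.Binary.Core using (Rel)
open import Function.Bundles using (_⇔_)

-- Sets P ⊆ U are predicates on an ambient type U; a relation on P is a
-- relation on U of which only the restriction to P matters.

record IsPartialOrderOn {ℓ : Level} {U : Set ℓ} (P : Pred U ℓ) (R : Rel U ℓ) : Set ℓ where
  field
    refl-on  : ∀ x → x ∈ P → R x x
    antisym  : ∀ x y → x ∈ P → y ∈ P → R x y → R y x → x ≡ y
    trans-on : ∀ x y z → x ∈ P → y ∈ P → z ∈ P → R x y → R y z → R x z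

record IsOrderIso {ℓ : Level} {U : Set ℓ} (P₁ P₂ : Pred U ℓ) (R₁ R₂ : Rel U ℓ) (Ψ : U → U) : Set ℓ where
  field
    maps-into : ∀ x → x ∈ P₁ → Ψ x ∈ P₂
    onto      : ∀ y → y ∈ P₂ → ∃[ x ] (x ∈ P₁ × Ψ x ≡ y)
    injective : ∀ x y → x ∈ P₁ → y ∈ P₁ → Ψ x ≡ Ψ y → x ≡ y
    order     : ∀ x y → x ∈ P₁ → y ∈ P₁ → (R₁ x y ⇔ R₂ (Ψ x) (Ψ y))

record Glues {ℓ : Level} {U : Set ℓ} (P₁ P₂ : Pred U ℓ) (R₁ R₂ : Rel U ℓ) (Ψ : U → U) (R₃ : Rel U ℓ) : Set ℓ where
  field
    cond-i   : ∀ x y → x ∈ P₁ → y ∈ P₁ → (R₃ x y ⇔ R₁ x y)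
    cond-ii  : ∀ x y → x ∈ P₂ → y ∈ P₂ → (R₃ x y ⇔ R₂ x y)
    cond-iii : ∀ x y → x ∈ P₁ → x ∉ P₂ → y ∈ P₂ → y ∉ P₁ → (R₃ x y ⇔ R₂ (Ψ x) y)
    cond-iv  : ∀ x y → x ∈ P₂ → x ∉ P₁ → y ∈ P₁ → y ∉ P₂ →
               (R₃ x y ⇔ (∃[ w ] (w ∈ (P₁ ∩ P₂) × R₂ x w × R₁ w y)))

module Submission where

-- Existence is constructive.  The glued relation x ⊴₃ y is defined by four
-- introduction rules, one for each of the conditions (i)–(iv): x ⊴₁ y inside
-- P₁, x ⊴₂ y inside P₂, Ψ x ⊴₂ y going "up" from P₁ to P₂, and x ⊴₂ w ⊴₁ y
-- going "down" from P₂ to P₁ through a point w of the overlap P₁ ∩ P₂.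
-- Because Ψ fixes the overlap, ⊴₁ and ⊴₂ are interchangeable there
-- (R₁⇔R₂Ψ-below, Ψ-source); with this every rule can be read back in each
-- of the four positions (glued⇒R₁, glued⇒R₂, glued⇒up, glued⇒through), which
-- gives (i)–(iv) and reduces reflexivity, transitivity and antisymmetry to
-- those of ⊴₁ and ⊴₂.
--
-- Uniqueness needs no order axioms at all: any two relations satisfying
-- (i)–(iv) agree on P₁ ∪ P₂.  It is classical, since deciding which of the
-- four conditions applies to a pair requires deciding membership in P₁, P₂.

open import Defs
open import Level using (Level)
open import Axiom.ExcludedMiddle using (ExcludedMiddle)
open import Data.Product using (_×_; _,_; ∃-syntax)
open import Data.Sum using (inj₁; inj₂)
open import Relation.Nullary using (yes; no)
open import Relation.Binary.PropositionalEquality using (_≡_; subst; sym)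
open import Relation.Unary using (Pred; _∈_; _∪_; _∩_)
open import Relation.Binary.Core using (Rel)
open import Function.Bundles using (_⇔_; mk⇔; Equivalence)
open import Function.Construct.Composition using (_⇔-∘_)
open import Function.Construct.Symmetry using (⇔-sym)

open Equivalence using (to; from)

glues-unique : {ℓ : Level} → ExcludedMiddle ℓ →
  {U : Set ℓ} {P₁ P₂ : Pred U ℓ} {R₁ R₂ : Rel U ℓ} {Ψ : U → U} {R S : Rel U ℓ} →
  Glues P₁ P₂ R₁ R₂ Ψ R → Glues P₁ P₂ R₁ R₂ Ψ S →
  ∀ x y → x ∈ (P₁ ∪ P₂) → y ∈ (P₁ ∪ P₂) → (R x y ⇔ S x y)
glues-unique lem {P₁ = P₁} {P₂} {R = R} {S} gR gS = agree
  where
    module R = Glues gR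
    module S = Glues gS

    agree : ∀ x y → x ∈ (P₁ ∪ P₂) → y ∈ (P₁ ∪ P₂) → (R x y ⇔ S x y)
    agree x y (inj₁ x₁) (inj₁ y₁) = ⇔-sym (S.cond-i x y x₁ y₁) ⇔-∘ R.cond-i x y x₁ y₁
    agree x y (inj₂ x₂) (inj₂ y₂) = ⇔-sym (S.cond-ii x y x₂ y₂) ⇔-∘ R.cond-ii x y x₂ y₂
    agree x y (inj₁ x₁) (inj₂ y₂) with lem {x ∈ P₂} | lem {y ∈ P₁}
    ... | yes x₂ | _      = agree x y (inj₂ x₂) (inj₂ y₂)
    ... | no _   | yes y₁ = agree x y (inj₁ x₁) (inj₁ y₁)
    ... | no x∉₂ | no y∉₁ =
      ⇔-sym (S.cond-iii x y x₁ x∉₂ y₂ y∉₁) ⇔-∘ R.cond-iii x y x₁ x∉₂ y₂ y∉₁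
    agree x y (inj₂ x₂) (inj₁ y₁) with lem {x ∈ P₁} | lem {y ∈ P₂}
    ... | yes x₁ | _      = agree x y (inj₁ x₁) (inj₁ y₁)
    ... | no _   | yes y₂ = agree x y (inj₂ x₂) (inj₂ y₂)
    ... | no x∉₁ | no y∉₂ =
      ⇔-sym (S.cond-iv x y x₂ x∉₁ y₁ y∉₂) ⇔-∘ R.cond-iv x y x₂ x∉₁ y₁ y∉₂

module Gluing {ℓ : Level} {U : Set ℓ} (P₁ P₂ : Pred U ℓ) (R₁ R₂ : Rel U ℓ) (Ψ : U → U)
    (po₁ : IsPartialOrderOn P₁ R₁) (po₂ : IsPartialOrderOn P₂ R₂)
    (Ψ-into : ∀ x → x ∈ P₁ → Ψ x ∈ P₂)
    (Ψ-order : ∀ x y → x ∈ P₁ → y ∈ P₁ → (R₁ x y ⇔ R₂ (Ψ x) (Ψ y)))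
    (Ψ-fix : ∀ x → x ∈ (P₁ ∩ P₂) → Ψ x ≡ x) where

  open IsPartialOrderOn po₁ renaming (refl-on to refl₁; antisym to antisym₁; trans-on to trans₁)
  open IsPartialOrderOn po₂ renaming (refl-on to refl₂; antisym to antisym₂; trans-on to trans₂)

  Through : Rel U ℓ
  Through x y = ∃[ w ] (w ∈ (P₁ ∩ P₂) × R₂ x w × R₁ w y)

  data Glued (x y : U) : Set ℓ where
    in₁  : x ∈ P₁ → y ∈ P₁ → R₁ x y → Glued x y
    in₂  : x ∈ P₂ → y ∈ P₂ → R₂ x y → Glued x y
    up   : x ∈ P₁ → y ∈ P₂ → R₂ (Ψ x) y → Glued x y
    down : x ∈ P₂ → y ∈ P₁ → Through x y → Glued x y

  R₁⇔R₂Ψ-below : ∀ {x w} → x ∈ P₁ → w ∈ (P₁ ∩ P₂) → (R₁ x w ⇔ R₂ (Ψ x) w)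
  R₁⇔R₂Ψ-below {x} {w} x₁ w₁₂@(w₁ , _) = mk⇔
    (λ r → subst (R₂ (Ψ x)) Ψw≡w (to (Ψ-order x w x₁ w₁) r))
    (λ r → from (Ψ-order x w x₁ w₁) (subst (R₂ (Ψ x)) (sym Ψw≡w) r))
    where Ψw≡w = Ψ-fix w w₁₂

  Ψ-source : ∀ {x y} → x ∈ (P₁ ∩ P₂) → (R₂ (Ψ x) y ⇔ R₂ x y)
  Ψ-source {x} {y} x₁₂ = mk⇔
    (subst (λ z → R₂ z y) (Ψ-fix x x₁₂))
    (subst (λ z → R₂ z y) (sym (Ψ-fix x x₁₂)))

  glued⇒R₁ : ∀ {x y} → Glued x y → x ∈ P₁ → y ∈ P₁ → R₁ x y
  glued⇒R₁ (in₁ _ _ r) _ _ = r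
  glued⇒R₁ (in₂ x₂ y₂ r) x₁ y₁ = from (R₁⇔R₂Ψ-below x₁ (y₁ , y₂)) (from (Ψ-source (x₁ , x₂)) r)
  glued⇒R₁ (up _ y₂ r) x₁ y₁ = from (R₁⇔R₂Ψ-below x₁ (y₁ , y₂)) r
  glued⇒R₁ {x} {y} (down x₂ _ (w , w₁₂@(w₁ , _) , x⊴w , w⊴y)) x₁ y₁ =
    trans₁ x w y x₁ w₁ y₁ (from (R₁⇔R₂Ψ-below x₁ w₁₂) (from (Ψ-source (x₁ , x₂)) x⊴w)) w⊴y

  glued⇒R₂ : ∀ {x y} → Glued x y → x ∈ P₂ → y ∈ P₂ → R₂ x y
  glued⇒R₂ (in₁ x₁ y₁ r) x₂ y₂ = to (Ψ-source (x₁ , x₂)) (to (R₁⇔R₂Ψ-below x₁ (y₁ , y₂)) r)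
  glued⇒R₂ (in₂ _ _ r) _ _ = r
  glued⇒R₂ (up x₁ _ r) x₂ _ = to (Ψ-source (x₁ , x₂)) r
  glued⇒R₂ {x} {y} (down _ y₁ (w , w₁₂@(w₁ , w₂) , x⊴w , w⊴y)) x₂ y₂ =
    trans₂ x w y x₂ w₂ y₂ x⊴w (to (Ψ-source w₁₂) (to (R₁⇔R₂Ψ-below w₁ (y₁ , y₂)) w⊴y))

  glued⇒up : ∀ {x y} → Glued x y → x ∈ P₁ → y ∈ P₂ → R₂ (Ψ x) y
  glued⇒up (in₁ _ y₁ r) x₁ y₂ = to (R₁⇔R₂Ψ-below x₁ (y₁ , y₂)) r
  glued⇒up t@(in₂ x₂ _ _) x₁ y₂ = from (Ψ-source (x₁ , x₂)) (glued⇒R₂ t x₂ y₂)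
  glued⇒up (up _ _ r) _ _ = r
  glued⇒up t@(down x₂ _ _) x₁ y₂ = from (Ψ-source (x₁ , x₂)) (glued⇒R₂ t x₂ y₂)

  glued⇒through : ∀ {x y} → Glued x y → x ∈ P₂ → y ∈ P₁ → Through x y
  glued⇒through {x} t@(in₁ x₁ _ _) x₂ y₁ = x , (x₁ , x₂) , refl₂ x x₂ , glued⇒R₁ t x₁ y₁
  glued⇒through {y = y} (in₂ _ y₂ r) _ y₁ = y , (y₁ , y₂) , r , refl₁ y y₁
  glued⇒through {x} t@(up x₁ _ _) x₂ y₁ = x , (x₁ , x₂) , refl₂ x x₂ , glued⇒R₁ t x₁ y₁
  glued⇒through (down _ _ p) _ _ = p

  up-then-down : ∀ {x y w} → x ∈ P₁ → y ∈ P₂ → w ∈ (P₁ ∩ P₂) →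
                 Glued x y → R₂ y w → R₁ x w
  up-then-down {x} {y} {w} x₁ y₂ w₁₂@(_ , w₂) x⊴y y⊴w =
    from (R₁⇔R₂Ψ-below x₁ w₁₂) (trans₂ (Ψ x) y w (Ψ-into x x₁) y₂ w₂ (glued⇒up x⊴y x₁ y₂) y⊴w)

  R₁-then-up : ∀ {x y z} → x ∈ P₁ → y ∈ P₁ → z ∈ P₂ → R₁ x y → Glued y z → R₂ (Ψ x) z
  R₁-then-up {x} {y} {z} x₁ y₁ z₂ x⊴y y⊴z =
    trans₂ (Ψ x) (Ψ y) z (Ψ-into x x₁) (Ψ-into y y₁) z₂ (to (Ψ-order x y x₁ y₁) x⊴y) (glued⇒up y⊴z y₁ z₂)

  glued-refl : ∀ x → x ∈ (P₁ ∪ P₂) → Glued x x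
  glued-refl x (inj₁ x₁) = in₁ x₁ x₁ (refl₁ x x₁)
  glued-refl x (inj₂ x₂) = in₂ x₂ x₂ (refl₂ x x₂)

  glued-trans : ∀ x y z → x ∈ (P₁ ∪ P₂) → y ∈ (P₁ ∪ P₂) → z ∈ (P₁ ∪ P₂) →
                Glued x y → Glued y z → Glued x z
  glued-trans x y z (inj₁ x₁) (inj₁ y₁) (inj₁ z₁) s t =
    in₁ x₁ z₁ (trans₁ x y z x₁ y₁ z₁ (glued⇒R₁ s x₁ y₁) (glued⇒R₁ t y₁ z₁))
  glued-trans x y z (inj₂ x₂) (inj₂ y₂) (inj₂ z₂) s t =
    in₂ x₂ z₂ (trans₂ x y z x₂ y₂ z₂ (glued⇒R₂ s x₂ y₂) (glued⇒R₂ t y₂ z₂))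
  glued-trans x y z (inj₁ x₁) (inj₁ y₁) (inj₂ z₂) s t =
    up x₁ z₂ (R₁-then-up x₁ y₁ z₂ (glued⇒R₁ s x₁ y₁) t)
  glued-trans x y z (inj₁ x₁) (inj₂ y₂) (inj₂ z₂) s t =
    up x₁ z₂ (trans₂ (Ψ x) y z (Ψ-into x x₁) y₂ z₂ (glued⇒up s x₁ y₂) (glued⇒R₂ t y₂ z₂))
  glued-trans x y z (inj₂ x₂) (inj₂ y₂) (inj₁ z₁) s t with glued⇒through t y₂ z₁
  ... | w , w₁₂@(_ , w₂) , y⊴w , w⊴z =
    down x₂ z₁ (w , w₁₂ , trans₂ x y w x₂ y₂ w₂ (glued⇒R₂ s x₂ y₂) y⊴w , w⊴z)
  glued-trans x y z (inj₂ x₂) (inj₁ y₁) (inj₁ z₁) s t with glued⇒through s x₂ y₁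
  ... | w , w₁₂@(w₁ , _) , x⊴w , w⊴y =
    down x₂ z₁ (w , w₁₂ , x⊴w , trans₁ w y z w₁ y₁ z₁ w⊴y (glued⇒R₁ t y₁ z₁))
  glued-trans x y z (inj₁ x₁) (inj₂ y₂) (inj₁ z₁) s t with glued⇒through t y₂ z₁
  ... | w , w₁₂@(w₁ , _) , y⊴w , w⊴z =
    in₁ x₁ z₁ (trans₁ x w z x₁ w₁ z₁ (up-then-down x₁ y₂ w₁₂ s y⊴w) w⊴z)
  glued-trans x y z (inj₂ x₂) (inj₁ y₁) (inj₂ z₂) s t with glued⇒through s x₂ y₁
  ... | w , w₁₂@(w₁ , w₂) , x⊴w , w⊴y =
    in₂ x₂ z₂ (trans₂ x w z x₂ w₂ z₂ x⊴w (to (Ψ-source w₁₂) (R₁-then-up w₁ y₁ z₂ w⊴y t)))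

  -- A mixed pair x ∈ P₁, y ∈ P₂ with x ⊴₃ y ⊴₃ x: y descends to x through
  -- some w, and x ⊴₁ w ⊴₁ x forces x ≡ w ∈ P₂; now both points lie in P₂.
  glued-antisym-mixed : ∀ x y → x ∈ P₁ → y ∈ P₂ → Glued x y → Glued y x → x ≡ y
  glued-antisym-mixed x y x₁ y₂ x⊴y y⊴x with glued⇒through y⊴x y₂ x₁
  ... | w , w₁₂@(w₁ , w₂) , y⊴w , w⊴x =
    antisym₂ x y x₂ y₂ (glued⇒R₂ x⊴y x₂ y₂) (glued⇒R₂ y⊴x y₂ x₂)
    where
      x≡w : x ≡ w
      x≡w = antisym₁ x w x₁ w₁ (up-then-down x₁ y₂ w₁₂ x⊴y y⊴w) w⊴x
      x₂ : x ∈ P₂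
      x₂ = subst P₂ (sym x≡w) w₂

  glued-antisym : ∀ x y → x ∈ (P₁ ∪ P₂) → y ∈ (P₁ ∪ P₂) → Glued x y → Glued y x → x ≡ y
  glued-antisym x y (inj₁ x₁) (inj₁ y₁) s t = antisym₁ x y x₁ y₁ (glued⇒R₁ s x₁ y₁) (glued⇒R₁ t y₁ x₁)
  glued-antisym x y (inj₂ x₂) (inj₂ y₂) s t = antisym₂ x y x₂ y₂ (glued⇒R₂ s x₂ y₂) (glued⇒R₂ t y₂ x₂)
  glued-antisym x y (inj₁ x₁) (inj₂ y₂) s t = glued-antisym-mixed x y x₁ y₂ s t
  glued-antisym x y (inj₂ x₂) (inj₁ y₁) s t = sym (glued-antisym-mixed y x y₁ x₂ t s)

  glued-partial-order : IsPartialOrderOn (P₁ ∪ P₂) Glued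
  glued-partial-order = record
    { refl-on = glued-refl ; antisym = glued-antisym ; trans-on = glued-trans }

  -- Conditions (i)–(iv): each rule of ⊴₃ is equivalent to the corresponding
  -- read-back.
  glued-glues : Glues P₁ P₂ R₁ R₂ Ψ Glued
  glued-glues = record
    { cond-i   = λ x y x₁ y₁ → mk⇔ (λ t → glued⇒R₁ t x₁ y₁) (in₁ x₁ y₁)
    ; cond-ii  = λ x y x₂ y₂ → mk⇔ (λ t → glued⇒R₂ t x₂ y₂) (in₂ x₂ y₂)
    ; cond-iii = λ x y x₁ _ y₂ _ → mk⇔ (λ t → glued⇒up t x₁ y₂) (up x₁ y₂)
    ; cond-iv  = λ x y x₂ _ y₁ _ → mk⇔ (λ t → glued⇒through t x₂ y₁) (down x₂ y₁)
    }

lemma3p3 : {ℓ : Level} → ExcludedMiddle ℓ →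
    {U : Set ℓ} (P₁ P₂ : Pred U ℓ) (R₁ R₂ : Rel U ℓ) (Ψ : U → U) →
    IsPartialOrderOn P₁ R₁ → IsPartialOrderOn P₂ R₂ →
    IsOrderIso P₁ P₂ R₁ R₂ Ψ →
    (∀ x → x ∈ (P₁ ∩ P₂) → Ψ x ≡ x) →
    ∃[ R₃ ] (IsPartialOrderOn (P₁ ∪ P₂) R₃ × Glues P₁ P₂ R₁ R₂ Ψ R₃ ×
      (∀ (R : Rel U ℓ) → IsPartialOrderOn (P₁ ∪ P₂) R → Glues P₁ P₂ R₁ R₂ Ψ R →
        ∀ x y → x ∈ (P₁ ∪ P₂) → y ∈ (P₁ ∪ P₂) → (R x y ⇔ R₃ x y)))
lemma3p3 lem P₁ P₂ R₁ R₂ Ψ po₁ po₂ iso Ψ-fix =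
  Glued , glued-partial-order , glued-glues ,
  λ R _ R-glues → glues-unique lem R-glues glued-glues
  where
    open IsOrderIso iso using (maps-into; order)
    open Gluing P₁ P₂ R₁ R₂ Ψ po₁ po₂ maps-into order Ψ-fix
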